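{- Let $r\geq 2$ and $k\geq 1$ be integers and let $n\geq r(k+r)$. Then $\gamma_{\times k}(K(n,r))=k+r$.
   Context: The Kneser graph $K(n,r)$ has as vertices the $r$-subsets of $[n]=\{1,\dots,n\}$, two vertices adjacent iff disjoint. For a vertex $v$, $N[v]$ is its closed neighbourhood. A set $D$ of vertices is a $k$-tuple dominating set if $|N[v]\cap D|\geq k$ for every vertex $v$; $\gamma_{\times k}(K(n,r))$ is the minimum cardinality of such a set. Standing assumption: $n\geq 2r+1$ and $r\geq 2$. -}

module Defs where

open import Data.Nat using (ℕ; _≤_)
open import Data.Bool using (Bool)
import Data.Bool as B
open import Data.Fin.Subset using (Subset; ∣_∣; _∩_; ⊥)
open import Data.Vec.Properties using (≡-dec)
open import Data.Product using (Σ; proj₁; _×_; ∃)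
open import Data.Sum using (_⊎_)
open import Data.List using (List; length; filter)
open import Data.List.Relation.Unary.Unique.Propositional using (Unique)
open import Data.List.Relation.Unary.All using (All)
open import Relation.Binary.PropositionalEquality using (_≡_)
open import Relation.Nullary using (Dec)
open import Relation.Nullary.Decidable using (_⊎-dec_)

-- Vertices of the Kneser graph K(n,r): r-subsets of [n] (encoded as Fin n).
Vertex : ℕ → ℕ → Set
Vertex n r = Σ (Subset n) λ s → ∣ s ∣ ≡ r

_≟S_ : ∀ {n} (p q : Subset n) → Dec (p ≡ q)
_≟S_ = ≡-dec B._≟_

Adjacent : ∀ {n r} → Vertex n r → Vertex n r → Set
Adjacent u v = proj₁ u ∩ proj₁ v ≡ ⊥

-- u ∈ N[v] (closed neighbourhood): u = v or u adjacent to v.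
InClosedNbhd : ∀ {n r} → Vertex n r → Vertex n r → Set
InClosedNbhd v u = (proj₁ u ≡ proj₁ v) ⊎ Adjacent u v

inClosedNbhd? : ∀ {n r} (v u : Vertex n r) → Dec (InClosedNbhd v u)
inClosedNbhd? v u = (proj₁ u ≟S proj₁ v) ⊎-dec ((proj₁ u ∩ proj₁ v) ≟S ⊥)

-- A set of vertices, represented as a duplicate-free list of vertices.
-- (Vertices are compared by their underlying subset.)
VertexSet : ℕ → ℕ → Set
VertexSet n r = Σ (List (Vertex n r)) λ xs → Unique (Data.List.map proj₁ xs)
  where import Data.List

nbhdCount : ∀ {n r} → VertexSet n r → Vertex n r → ℕ
nbhdCount D v = length (filter (inClosedNbhd? v) (proj₁ D))

size : ∀ {n r} → VertexSet n r → ℕ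
size D = length (proj₁ D)

IsKTupleDominating : ∀ {n r} → ℕ → VertexSet n r → Set
IsKTupleDominating {n} {r} k D = (v : Vertex n r) → k ≤ nbhdCount D v

KTupleDomNumberIs : ℕ → ℕ → ℕ → ℕ → Set
KTupleDomNumberIs n r k m =
  (Σ (VertexSet n r) λ D → IsKTupleDominating k D × size D ≡ m) ×
  ((D : VertexSet n r) → IsKTupleDominating k D → m ≤ size D)

-- Upper bound: k + r pairwise disjoint r-sets fit into [n], and a vertex v meets at most r of
-- them because each one uses up a point of v; the other k are disjoint from v, so lie in N[v].
-- Lower bound: let D be k-tuple dominating and take r of its members (all of them if |D| < r).
-- They cover at most r * r < n points, so some point y lies in none of them. If they have a
-- transversal of fewer than r points, add y and pad to an r-set v; otherwise they are r ≥ 2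
-- pairwise disjoint sets and any r-set v containing a transversal will do. Either way v meets
-- each chosen member and differs from it, so none of them lies in N[v]: k ≤ |N[v] ∩ D| ≤ |D| - r.

module Submission where

open import Defs
open import Data.Nat using (ℕ; _+_; _*_; _≤_)
open import Data.Nat using (zero; suc; _<_; _∸_; _⊓_; z≤n; s≤s; _≤?_; >-nonZero)
open import Data.Nat.Properties
open import Data.Fin using (Fin)
open import Data.Fin.Subset
  using (Subset; inside; outside; ∣_∣; _∩_; _∪_; _-_; ⊥; ⊤; ⁅_⁆; ⋃; _∈_; _∉_; _⊆_; ∁; Nonempty)
open import Data.Fin.Subset.Properties
open import Data.Vec using ([]; _∷_; here)
open import Data.Product using (Σ; ∃; _×_; _,_; proj₁; proj₂; map₂)
open import Data.Sum using (_⊎_; inj₁; inj₂; [_,_]′)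
open import Data.List using (List; []; _∷_; length; filter; take; map)
open import Data.List.Properties using (length-filter; length-map; length-take)
open import Data.List.Relation.Unary.All as All using (All; []; _∷_)
open import Data.List.Relation.Unary.All.Properties using (¬Any⇒All¬; map⁻)
open import Data.List.Relation.Unary.Any using (Any; here; there; any?)
open import Data.List.Relation.Unary.AllPairs as AllPairs using (AllPairs; []; _∷_)
open import Data.List.Relation.Unary.AllPairs.Properties using () renaming (map⁺ to AllPairs-map⁺)
open import Data.List.Relation.Unary.Unique.Propositional using (Unique)
open import Function using (_on_; _∘_)
open import Relation.Unary using (Decidable)
open import Relation.Binary.PropositionalEquality using (_≡_; _≢_; refl; sym; trans; cong; subst)
open import Relation.Nullary using (¬_; Dec; yes; no; contradiction)

private variable
  n m o r : ℕ
  x : Fin n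
  p q d S T v : Subset n
  L : List (Subset n)

module _ {A : Set} {P Q : A → Set} (P? : Decidable P) (Q? : Decidable Q) where

  length-filter-mono : (xs : List A) → All (λ x → P x → Q x) xs →
                       length (filter P? xs) ≤ length (filter Q? xs)
  length-filter-mono []       []             = z≤n
  length-filter-mono (x ∷ xs) (P⇒Q ∷ P⇒Qs) with P? x | Q? x
  ... | yes _  | yes _  = s≤s (length-filter-mono xs P⇒Qs)
  ... | yes Px | no ¬Qx = contradiction (P⇒Q Px) ¬Qx
  ... | no  _  | yes _  = m≤n⇒m≤1+n (length-filter-mono xs P⇒Qs)
  ... | no  _  | no  _  = length-filter-mono xs P⇒Qs

  length≤length-filter+length-filter : (∀ x → ¬ Q x → P x) → (xs : List A) →
                                       length xs ≤ length (filter P? xs) + length (filter Q? xs)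
  length≤length-filter+length-filter ¬Q⇒P []       = z≤n
  length≤length-filter+length-filter ¬Q⇒P (x ∷ xs)
    with ih ← length≤length-filter+length-filter ¬Q⇒P xs | P? x | Q? x
  ... | yes _ | yes _  = s≤s (≤-trans ih (+-monoʳ-≤ _ (n≤1+n _)))
  ... | yes _ | no  _  = s≤s ih
  ... | no  _ | yes _  = subst (suc (length xs) ≤_) (sym (+-suc _ _)) (s≤s ih)
  ... | no ¬Px | no ¬Qx = contradiction (¬Q⇒P x ¬Qx) ¬Px

length-filter≤length∸ : {A : Set} {P : A → Set} (P? : Decidable P) (m : ℕ) (xs : List A) →
                        All (¬_ ∘ P) (take m xs) → length (filter P? xs) ≤ length xs ∸ m
length-filter≤length∸ P? zero    xs       _           = length-filter P? xs
length-filter≤length∸ P? (suc m) []       _           = z≤n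
length-filter≤length∸ P? (suc m) (x ∷ xs) (¬Px ∷ ¬Ps) with P? x
... | yes Px = contradiction Px ¬Px
... | no  _  = length-filter≤length∸ P? m xs ¬Ps

1≤m≤o∸n⇒m+n≤o : 1 ≤ m → m ≤ o ∸ n → m + n ≤ o
1≤m≤o∸n⇒m+n≤o {m} 1≤m m≤o∸n =
  m≤o∸n⇒m+n≤o m (<⇒≤ (m∸n≢0⇒n<m (>⇒≢ (≤-trans 1≤m m≤o∸n)))) m≤o∸n

∣p∪q∣≤∣p∣+∣q∣ : (p q : Subset n) → ∣ p ∪ q ∣ ≤ ∣ p ∣ + ∣ q ∣
∣p∪q∣≤∣p∣+∣q∣ []            []            = z≤n
∣p∪q∣≤∣p∣+∣q∣ (inside  ∷ p) (inside  ∷ q) =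
  s≤s (≤-trans (∣p∪q∣≤∣p∣+∣q∣ p q) (+-monoʳ-≤ ∣ p ∣ (n≤1+n ∣ q ∣)))
∣p∪q∣≤∣p∣+∣q∣ (inside  ∷ p) (outside ∷ q) = s≤s (∣p∪q∣≤∣p∣+∣q∣ p q)
∣p∪q∣≤∣p∣+∣q∣ (outside ∷ p) (inside  ∷ q) =
  subst (suc ∣ p ∪ q ∣ ≤_) (sym (+-suc ∣ p ∣ ∣ q ∣)) (s≤s (∣p∪q∣≤∣p∣+∣q∣ p q))
∣p∪q∣≤∣p∣+∣q∣ (outside ∷ p) (outside ∷ q) = ∣p∪q∣≤∣p∣+∣q∣ p q

∣p∣≤m⇒∣⁅x⁆∪p∣≤1+m : (x : Fin n) → ∣ p ∣ ≤ m → ∣ ⁅ x ⁆ ∪ p ∣ ≤ suc m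
∣p∣≤m⇒∣⁅x⁆∪p∣≤1+m {p = p} x ∣p∣≤m = begin
  ∣ ⁅ x ⁆ ∪ p ∣     ≤⟨ ∣p∪q∣≤∣p∣+∣q∣ ⁅ x ⁆ p ⟩
  ∣ ⁅ x ⁆ ∣ + ∣ p ∣ ≡⟨ cong (_+ ∣ p ∣) (∣⁅x⁆∣≡1 x) ⟩
  suc ∣ p ∣         ≤⟨ s≤s ∣p∣≤m ⟩
  suc _             ∎
  where open ≤-Reasoning

∣p∣≤∣p∩∁q∣+∣q∣ : (p q : Subset n) → ∣ p ∣ ≤ ∣ p ∩ ∁ q ∣ + ∣ q ∣
∣p∣≤∣p∩∁q∣+∣q∣ []            []            = z≤n
∣p∣≤∣p∩∁q∣+∣q∣ (inside  ∷ p) (inside  ∷ q) =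
  subst (suc ∣ p ∣ ≤_) (sym (+-suc ∣ p ∩ ∁ q ∣ ∣ q ∣)) (s≤s (∣p∣≤∣p∩∁q∣+∣q∣ p q))
∣p∣≤∣p∩∁q∣+∣q∣ (inside  ∷ p) (outside ∷ q) = s≤s (∣p∣≤∣p∩∁q∣+∣q∣ p q)
∣p∣≤∣p∩∁q∣+∣q∣ (outside ∷ p) (inside  ∷ q) =
  ≤-trans (∣p∣≤∣p∩∁q∣+∣q∣ p q) (+-monoʳ-≤ _ (n≤1+n ∣ q ∣))
∣p∣≤∣p∩∁q∣+∣q∣ (outside ∷ p) (outside ∷ q) = ∣p∣≤∣p∩∁q∣+∣q∣ p q

∣q∣+m≤∣p∣⇒m≤∣p∩∁q∣ : (p q : Subset n) → ∣ q ∣ + m ≤ ∣ p ∣ → m ≤ ∣ p ∩ ∁ q ∣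
∣q∣+m≤∣p∣⇒m≤∣p∩∁q∣ {m = m} p q ∣q∣+m≤∣p∣ = +-cancelˡ-≤ ∣ q ∣ m _ (begin
  ∣ q ∣ + m           ≤⟨ ∣q∣+m≤∣p∣ ⟩
  ∣ p ∣               ≤⟨ ∣p∣≤∣p∩∁q∣+∣q∣ p q ⟩
  ∣ p ∩ ∁ q ∣ + ∣ q ∣ ≡⟨ +-comm (∣ p ∩ ∁ q ∣) ∣ q ∣ ⟩
  ∣ q ∣ + ∣ p ∩ ∁ q ∣ ∎)
  where open ≤-Reasoning

0<∣p∣⇒Nonempty : (p : Subset n) → 0 < ∣ p ∣ → Nonempty p
0<∣p∣⇒Nonempty {n} p 0<∣p∣ with nonempty? p
... | yes p≢∅ = p≢∅
... | no  p≡∅ = contradiction (trans (cong ∣_∣ (Empty-unique p≡∅)) (∣⊥∣≡0 n)) (>⇒≢ 0<∣p∣)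

∣p∣<n⇒∃∉p : (p : Subset n) → ∣ p ∣ < n → ∃ λ x → x ∉ p
∣p∣<n⇒∃∉p {n} p ∣p∣<n = map₂ x∈∁p⇒x∉p (0<∣p∣⇒Nonempty (∁ p) 0<∣∁p∣)
  where
  0<∣∁p∣ : 0 < ∣ ∁ p ∣
  0<∣∁p∣ = subst (0 <_) (sym (∣∁p∣≡n∸∣p∣ p)) (m<n⇒0<n∸m ∣p∣<n)

⊆-interpolate : (p A : Subset n) → p ⊆ A → ∣ p ∣ ≤ m → m ≤ ∣ A ∣ →
                ∃ λ q → p ⊆ q × q ⊆ A × ∣ q ∣ ≡ m
⊆-interpolate [] [] _ z≤n z≤n = [] , (λ ()) , (λ ()) , refl
⊆-interpolate (inside ∷ p) (outside ∷ A) p⊆A _ _ with () ← p⊆A here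
⊆-interpolate (inside ∷ p) (inside ∷ A) p⊆A (s≤s ∣p∣≤m) (s≤s m≤∣A∣)
  with q , p⊆q , q⊆A , ∣q∣≡m ← ⊆-interpolate p A (drop-∷-⊆ p⊆A) ∣p∣≤m m≤∣A∣ =
  inside ∷ q , in⊆in p⊆q , in⊆in q⊆A , cong suc ∣q∣≡m
⊆-interpolate (outside ∷ p) (outside ∷ A) p⊆A ∣p∣≤m m≤∣A∣
  with q , p⊆q , q⊆A , ∣q∣≡m ← ⊆-interpolate p A (drop-∷-⊆ p⊆A) ∣p∣≤m m≤∣A∣ =
  outside ∷ q , s⊆s p⊆q , s⊆s q⊆A , ∣q∣≡m
⊆-interpolate {m = m} (outside ∷ p) (inside ∷ A) p⊆A ∣p∣≤m m≤1+∣A∣ with m ≤? ∣ A ∣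
... | yes m≤∣A∣ with q , p⊆q , q⊆A , ∣q∣≡m ← ⊆-interpolate p A (drop-∷-⊆ p⊆A) ∣p∣≤m m≤∣A∣ =
  outside ∷ q , out⊆ p⊆q , out⊆ q⊆A , ∣q∣≡m
... | no  m≰∣A∣ =
  inside ∷ A , out⊆ (drop-∷-⊆ p⊆A) , (λ x∈A → x∈A) , ≤-antisym (≰⇒> m≰∣A∣) m≤1+∣A∣

⊆-extend : (p : Subset n) → ∣ p ∣ ≤ m → m ≤ n → ∃ λ q → p ⊆ q × ∣ q ∣ ≡ m
⊆-extend {n} {m} p ∣p∣≤m m≤n
  with q , p⊆q , _ , ∣q∣≡m ← ⊆-interpolate p ⊤ ⊆⊤ ∣p∣≤m (subst (m ≤_) (sym (∣⊤∣≡n n)) m≤n) =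
  q , p⊆q , ∣q∣≡m

Meets : Subset n → Subset n → Set
Meets p q = ∃ λ x → x ∈ p × x ∈ q

Disjoint : Subset n → Subset n → Set
Disjoint p q = ¬ Meets p q

meets? : (p q : Subset n) → Dec (Meets p q)
meets? p q with nonempty? (p ∩ q)
... | yes (x , x∈p∩q) = yes (x , x∈p∩q⁻ p q x∈p∩q)
... | no  p∩q≡∅       = no λ (x , x∈p , x∈q) → p∩q≡∅ (x , x∈p∩q⁺ (x∈p , x∈q))

meets-sym : Meets p q → Meets q p
meets-sym (x , x∈p , x∈q) = x , x∈q , x∈p

meets-⊆ : q ⊆ T → Meets p q → Meets p T
meets-⊆ q⊆T (x , x∈p , x∈q) = x , x∈p , q⊆T x∈q

Meets⇒∩≢⊥ : Meets p q → p ∩ q ≢ ⊥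
Meets⇒∩≢⊥ (x , x∈p , x∈q) p∩q≡⊥ = ∉⊥ (subst (x ∈_) p∩q≡⊥ (x∈p∩q⁺ (x∈p , x∈q)))

Disjoint⇒∩≡⊥ : (p q : Subset n) → Disjoint p q → p ∩ q ≡ ⊥
Disjoint⇒∩≡⊥ p q p⊥q = Empty-unique λ (x , x∈p∩q) → p⊥q (x , x∈p∩q⁻ p q x∈p∩q)

Nonempty∧Disjoint⇒≢ : Nonempty p → Disjoint p q → p ≢ q
Nonempty∧Disjoint⇒≢ (x , x∈p) p⊥q refl = p⊥q (x , x∈p , x∈p)

Hits : Subset n → List (Subset n) → Set
Hits S = All (λ d → Meets d S)

hits-⊆ : S ⊆ T → Hits S L → Hits T L
hits-⊆ S⊆T = All.map (meets-⊆ S⊆T)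

hits-∷ : x ∈ d → Hits S L → Hits (⁅ x ⁆ ∪ S) (d ∷ L)
hits-∷ {x = x} {S = S} x∈d hits = (x , x∈d , p⊆p∪q S (x∈⁅x⁆ x)) ∷ hits-⊆ (q⊆p∪q ⁅ x ⁆ S) hits

transversal : All Nonempty L → ∃ λ S → ∣ S ∣ ≤ length L × Hits S L
transversal {n} [] = ⊥ , ≤-reflexive (∣⊥∣≡0 n) , []
transversal ((x , x∈d) ∷ nonempty) with S , ∣S∣≤ , hits ← transversal nonempty =
  ⁅ x ⁆ ∪ S , ∣p∣≤m⇒∣⁅x⁆∪p∣≤1+m x ∣S∣≤ , hits-∷ x∈d hits

-- Choosing the point of d ∩ e as the representative of e makes it represent d too.
transversal-meeting : All Nonempty L → Any (Meets d) L →
                      ∃ λ S → ∣ S ∣ ≤ length L × Meets d S × Hits S L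
transversal-meeting (_ ∷ nonempty) (here (z , z∈d , z∈e))
  with S , ∣S∣≤ , hits ← transversal nonempty =
  ⁅ z ⁆ ∪ S , ∣p∣≤m⇒∣⁅x⁆∪p∣≤1+m z ∣S∣≤ , (z , z∈d , p⊆p∪q S (x∈⁅x⁆ z)) , hits-∷ z∈e hits
transversal-meeting ((x , x∈e) ∷ nonempty) (there meets)
  with S , ∣S∣≤ , d∩S , hits ← transversal-meeting nonempty meets =
  ⁅ x ⁆ ∪ S , ∣p∣≤m⇒∣⁅x⁆∪p∣≤1+m x ∣S∣≤ , meets-⊆ (q⊆p∪q ⁅ x ⁆ S) d∩S , hits-∷ x∈e hits

smallTransversal⊎pairwiseDisjoint : All Nonempty L →
  (∃ λ S → ∣ S ∣ < length L × Hits S L) ⊎ AllPairs Disjoint L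
smallTransversal⊎pairwiseDisjoint [] = inj₂ []
smallTransversal⊎pairwiseDisjoint {L = d ∷ L} ((x , x∈d) ∷ nonempty)
  with smallTransversal⊎pairwiseDisjoint nonempty
... | inj₁ (S , ∣S∣< , hits) =
  inj₁ (⁅ x ⁆ ∪ S , s≤s (≤-trans (∣p∣≤m⇒∣⁅x⁆∪p∣≤1+m x ≤-refl) ∣S∣<) , hits-∷ x∈d hits)
... | inj₂ pairwise with any? (meets? d) L
...   | yes meets with S , ∣S∣≤ , d∩S , hits ← transversal-meeting nonempty meets =
  inj₁ (S , s≤s ∣S∣≤ , d∩S ∷ hits)
...   | no ¬meets = inj₂ (¬Any⇒All¬ L ¬meets ∷ pairwise)

hits-pairwiseDisjoint⇒≢ : AllPairs Disjoint L → 2 ≤ length L → Hits v L → All (_≢ v) L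
hits-pairwiseDisjoint⇒≢ ((a⊥b ∷ a⊥rest) ∷ _) (s≤s (s≤s z≤n)) (a∩v ∷ b∩v ∷ _) =
  (λ { refl → a⊥b (meets-sym b∩v) }) ∷ (λ { refl → a⊥b a∩v }) ∷
  All.map (λ a⊥e → λ { refl → a⊥e a∩v }) a⊥rest

∣⋃∣≤length*r : ∀ {n r} {L : List (Subset n)} → All (λ d → ∣ d ∣ ≤ r) L → ∣ ⋃ L ∣ ≤ length L * r
∣⋃∣≤length*r {n} [] = ≤-reflexive (∣⊥∣≡0 n)
∣⋃∣≤length*r {L = d ∷ L} (∣d∣≤r ∷ sizes) =
  ≤-trans (∣p∪q∣≤∣p∣+∣q∣ d (⋃ L)) (+-mono-≤ ∣d∣≤r (∣⋃∣≤length*r sizes))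

x∉⋃⇒All∉ : (L : List (Subset n)) → x ∉ ⋃ L → All (x ∉_) L
x∉⋃⇒All∉ []      _     = []
x∉⋃⇒All∉ (d ∷ L) x∉⋃L =
  (λ x∈d → x∉⋃L (p⊆p∪q (⋃ L) x∈d)) ∷ x∉⋃⇒All∉ L (λ x∈⋃L → x∉⋃L (q⊆p∪q d (⋃ L) x∈⋃L))

OutsideNbhd : Subset n → Subset n → Set
OutsideNbhd v d = Meets d v × d ≢ v

UndominatedBy : (r : ℕ) → List (Subset n) → Set
UndominatedBy {n} r L = ∃ λ (v : Subset n) → ∣ v ∣ ≡ r × All (OutsideNbhd v) L

-- The point y, which lies in v but in no member of L, keeps v different from all of them.
extend-transversal-by-fresh : ∀ {n r} {L : List (Subset n)} {S} {y : Fin n} →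
                              r ≤ n → All (y ∉_) L → ∣ S ∣ < r → Hits S L → UndominatedBy r L
extend-transversal-by-fresh {S = S} {y} r≤n y∉L ∣S∣<r hits
  with v , y∪S⊆v , ∣v∣≡r ← ⊆-extend (⁅ y ⁆ ∪ S) (≤-trans (∣p∣≤m⇒∣⁅x⁆∪p∣≤1+m y ≤-refl) ∣S∣<r) r≤n =
  v , ∣v∣≡r , All.zipWith outsideNbhd (hits , y∉L)
  where
  outsideNbhd : ∀ {d} → Meets d S × y ∉ d → OutsideNbhd v d
  outsideNbhd (d∩S , y∉d) =
    meets-⊆ (λ x∈S → y∪S⊆v (q⊆p∪q ⁅ y ⁆ S x∈S)) d∩S ,
    λ { refl → y∉d (y∪S⊆v (p⊆p∪q S (x∈⁅x⁆ y))) }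

extend-transversal-of-disjoint : ∀ {n r} {L : List (Subset n)} {S} →
                                 r ≤ n → AllPairs Disjoint L → 2 ≤ length L → ∣ S ∣ ≤ r → Hits S L →
                                 UndominatedBy r L
extend-transversal-of-disjoint {S = S} r≤n pairwise 2≤∣L∣ ∣S∣≤r hits
  with v , S⊆v , ∣v∣≡r ← ⊆-extend S ∣S∣≤r r≤n =
  v , ∣v∣≡r , All.zip (hits-v , hits-pairwiseDisjoint⇒≢ pairwise 2≤∣L∣ hits-v)
  where
  hits-v : Hits v _
  hits-v = hits-⊆ S⊆v hits

∃-undominatedBy : ∀ {n r} → 2 ≤ r → r * r < n → (L : List (Subset n)) →
                  All (λ d → ∣ d ∣ ≡ r) L → length L ≤ r → UndominatedBy r L
∃-undominatedBy {n} {r} 2≤r r*r<n L sizes ∣L∣≤r =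
  [ (λ (S , ∣S∣<∣L∣ , hits) → by-fresh (≤-trans ∣S∣<∣L∣ ∣L∣≤r) hits) , by-disjointness ]′
    (smallTransversal⊎pairwiseDisjoint nonempty)
  where
  0<r : 0 < r
  0<r = <-≤-trans (s≤s z≤n) 2≤r

  r≤n : r ≤ n
  r≤n = ≤-trans (m≤m*n r r ⦃ >-nonZero 0<r ⦄) (<⇒≤ r*r<n)

  nonempty : All Nonempty L
  nonempty = All.map (λ {d} ∣d∣≡r → 0<∣p∣⇒Nonempty d (subst (0 <_) (sym ∣d∣≡r) 0<r)) sizes

  ∣⋃L∣<n : ∣ ⋃ L ∣ < n
  ∣⋃L∣<n = ≤-<-trans (≤-trans (∣⋃∣≤length*r (All.map ≤-reflexive sizes)) (*-monoˡ-≤ r ∣L∣≤r)) r*r<n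

  by-fresh : ∀ {S} → ∣ S ∣ < r → Hits S L → UndominatedBy r L
  by-fresh = extend-transversal-by-fresh r≤n (x∉⋃⇒All∉ L (proj₂ (∣p∣<n⇒∃∉p (⋃ L) ∣⋃L∣<n)))

  by-disjointness : AllPairs Disjoint L → UndominatedBy r L
  by-disjointness pairwise with S , ∣S∣≤∣L∣ , hits ← transversal nonempty | r ≤? length L
  ... | yes r≤∣L∣ =
    extend-transversal-of-disjoint r≤n pairwise (≤-trans 2≤r r≤∣L∣) (≤-trans ∣S∣≤∣L∣ ∣L∣≤r) hits
  ... | no  r≰∣L∣ = by-fresh (≤-<-trans ∣S∣≤∣L∣ (≰⇒> r≰∣L∣)) hits

DisjointVertices : List (Vertex n r) → Set
DisjointVertices = AllPairs (Disjoint on proj₁)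

vertex-nonempty : 0 < r → (v : Vertex n r) → Nonempty (proj₁ v)
vertex-nonempty 0<r (v , ∣v∣≡r) = 0<∣p∣⇒Nonempty v (subst (0 <_) (sym ∣v∣≡r) 0<r)

disjointVertices⇒Unique : 0 < r → {ds : List (Vertex n r)} → DisjointVertices ds →
                          Unique (map proj₁ ds)
disjointVertices⇒Unique 0<r disjoint =
  AllPairs-map⁺ (AllPairs.map (λ {u} → Nonempty∧Disjoint⇒≢ (vertex-nonempty 0<r u)) disjoint)

∃-disjointVertices : ∀ {n r} (c : ℕ) (A : Subset n) → c * r ≤ ∣ A ∣ →
  ∃ λ (ds : List (Vertex n r)) → length ds ≡ c × DisjointVertices ds × All (λ d → proj₁ d ⊆ A) ds
∃-disjointVertices zero A _ = [] , refl , [] , []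
∃-disjointVertices {n} {r} (suc c) A r+c*r≤∣A∣
  with q , _ , q⊆A , ∣q∣≡r ← ⊆-interpolate ⊥ A ⊥⊆ (≤-trans (≤-reflexive (∣⊥∣≡0 n)) z≤n)
                                 (≤-trans (m≤m+n r (c * r)) r+c*r≤∣A∣)
  with ds , length≡c , disjoint , ds⊆A∩∁q ← ∃-disjointVertices c (A ∩ ∁ q)
         (∣q∣+m≤∣p∣⇒m≤∣p∩∁q∣ A q (subst (λ s → s + c * r ≤ ∣ A ∣) (sym ∣q∣≡r) r+c*r≤∣A∣)) =
  (q , ∣q∣≡r) ∷ ds , cong suc length≡c ,
  All.map (λ d⊆A∩∁q (x , x∈q , x∈d) → x∈∁p⇒x∉p (p∩q⊆q A (∁ q) (d⊆A∩∁q x∈d)) x∈q) ds⊆A∩∁q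
    ∷ disjoint ,
  q⊆A ∷ All.map (λ d⊆A∩∁q {x} x∈d → p∩q⊆p A (∁ q) (d⊆A∩∁q x∈d)) ds⊆A∩∁q

-- Every point of w is in at most one of the disjoint vertices.
length-filter-meets≤∣w∣ : ∀ {n r} (w : Subset n) (ds : List (Vertex n r)) → DisjointVertices ds →
                          length (filter (λ d → meets? (proj₁ d) w) ds) ≤ ∣ w ∣
length-filter-meets≤∣w∣ w []       _                    = z≤n
length-filter-meets≤∣w∣ {n} {r} w (u ∷ ds) (u⊥ds ∷ disjoint) with meets? (proj₁ u) w
... | no  _                = length-filter-meets≤∣w∣ w ds disjoint
... | yes (x , x∈u , x∈w) = begin-strict
  length (filter (meets-at w) ds)       ≤⟨ length-filter-mono (meets-at w) (meets-at (w - x)) ds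
                                               (All.map (λ {e} → meets-w-x {e}) u⊥ds) ⟩
  length (filter (meets-at (w - x)) ds) ≤⟨ length-filter-meets≤∣w∣ (w - x) ds disjoint ⟩
  ∣ w - x ∣                             <⟨ x∈p⇒∣p-x∣<∣p∣ x∈w ⟩
  ∣ w ∣                                 ∎
  where
  open ≤-Reasoning
  meets-at : (w : Subset n) (d : Vertex n r) → Dec (Meets (proj₁ d) w)
  meets-at w d = meets? (proj₁ d) w
  meets-w-x : {e : Vertex n r} → Disjoint (proj₁ u) (proj₁ e) →
              Meets (proj₁ e) w → Meets (proj₁ e) (w - x)
  meets-w-x u⊥e (z , z∈e , z∈w) = z , z∈e , x∈p∧x≢y⇒x∈p-y z∈w λ { refl → u⊥e (z , x∈u , z∈e) }

OutsideNbhd⇒¬InClosedNbhd : {v u : Vertex n r} →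
                            OutsideNbhd (proj₁ v) (proj₁ u) → ¬ InClosedNbhd v u
OutsideNbhd⇒¬InClosedNbhd (_ , u≢v)   (inj₁ u≡v)   = u≢v u≡v
OutsideNbhd⇒¬InClosedNbhd (u∩v , _)   (inj₂ u∩v≡⊥) = Meets⇒∩≢⊥ u∩v u∩v≡⊥

size≤nbhdCount+r : ∀ {n r} (D : VertexSet n r) → DisjointVertices (proj₁ D) → (v : Vertex n r) →
                     size D ≤ nbhdCount D v + r
size≤nbhdCount+r {n} {r} D@(ds , _) disjoint v@(w , ∣w∣≡r) = begin
  length ds                                               ≤⟨ length≤length-filter+length-filter
                                                               (inClosedNbhd? v) meets-w adjacent ds ⟩
  nbhdCount D v + length (filter meets-w ds)              ≤⟨ +-monoʳ-≤ (nbhdCount D v)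
                                                               (length-filter-meets≤∣w∣ w ds disjoint) ⟩
  nbhdCount D v + ∣ w ∣                                   ≡⟨ cong (nbhdCount D v +_) ∣w∣≡r ⟩
  nbhdCount D v + r                                       ∎
  where
  open ≤-Reasoning
  meets-w : (u : Vertex n r) → Dec (Meets (proj₁ u) w)
  meets-w u = meets? (proj₁ u) w
  adjacent : (u : Vertex n r) → ¬ Meets (proj₁ u) w → InClosedNbhd v u
  adjacent (u , _) u⊥w = inj₂ (Disjoint⇒∩≡⊥ u w u⊥w)

∃-nbhdCount≤size∸r : ∀ {n r} → 2 ≤ r → r * r < n → (D : VertexSet n r) →
                     ∃ λ v → nbhdCount D v ≤ size D ∸ r
∃-nbhdCount≤size∸r {n} {r} 2≤r r*r<n D@(ds , _) =
  nbhdCount≤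
    (∃-undominatedBy 2≤r r*r<n (map proj₁ (take r ds)) (All.fromList (take r ds)) ∣prefix∣≤r)
  where
  ∣prefix∣≤r : length (map proj₁ (take r ds)) ≤ r
  ∣prefix∣≤r = begin
    length (map proj₁ (take r ds)) ≡⟨ length-map proj₁ (take r ds) ⟩
    length (take r ds)             ≡⟨ length-take r ds ⟩
    r ⊓ length ds                  ≤⟨ m⊓n≤m r (length ds) ⟩
    r                              ∎
    where open ≤-Reasoning
  nbhdCount≤ : UndominatedBy r (map proj₁ (take r ds)) → ∃ λ v → nbhdCount D v ≤ size D ∸ r
  nbhdCount≤ (v , ∣v∣≡r , undominated) =
    (v , ∣v∣≡r) ,
    length-filter≤length∸ (inClosedNbhd? (v , ∣v∣≡r)) r ds
      (All.map (λ {u} → OutsideNbhd⇒¬InClosedNbhd {v = v , ∣v∣≡r} {u}) (map⁻ undominated))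

∃-kTupleDominating : ∀ {n r} (k : ℕ) → 0 < r → (k + r) * r ≤ n →
                     Σ (VertexSet n r) λ D → IsKTupleDominating k D × size D ≡ k + r
∃-kTupleDominating {n} {r} k 0<r [k+r]*r≤n
  with ds , ∣ds∣≡k+r , disjoint , _ ← ∃-disjointVertices (k + r) ⊤
                                          (subst ((k + r) * r ≤_) (sym (∣⊤∣≡n n)) [k+r]*r≤n) =
  D , dominating , ∣ds∣≡k+r
  where
  D : VertexSet n r
  D = ds , disjointVertices⇒Unique 0<r disjoint
  dominating : IsKTupleDominating k D
  dominating v = +-cancelʳ-≤ r k (nbhdCount D v)
    (subst (_≤ nbhdCount D v + r) ∣ds∣≡k+r (size≤nbhdCount+r D disjoint v))

kTupleDominating⇒k+r≤size : ∀ {n r k} → 2 ≤ r → r * r < n → 1 ≤ k →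
                            (D : VertexSet n r) → IsKTupleDominating k D → k + r ≤ size D
kTupleDominating⇒k+r≤size 2≤r r*r<n 1≤k D dominating
  with v , nbhdCount≤ ← ∃-nbhdCount≤size∸r 2≤r r*r<n D =
  1≤m≤o∸n⇒m+n≤o 1≤k (≤-trans (dominating v) nbhdCount≤)

lemma9 : (n r k : ℕ) → 2 ≤ r → 1 ≤ k → r * (k + r) ≤ n →
    KTupleDomNumberIs n r k (k + r)
lemma9 n r k 2≤r 1≤k r[k+r]≤n =
  ∃-kTupleDominating k 0<r (subst (_≤ n) (*-comm r (k + r)) r[k+r]≤n) ,
  kTupleDominating⇒k+r≤size 2≤r r*r<n 1≤k
  where
  0<r : 0 < r
  0<r = <-≤-trans (s≤s z≤n) 2≤r
  r*r<n : r * r < n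
  r*r<n = <-≤-trans (*-monoʳ-< r ⦃ >-nonZero 0<r ⦄ (m<n+m r 1≤k)) r[k+r]≤n
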